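{- Assume the setting described in the context. If $|S_0| \le 2$ and $|S_1| \ge 4$, then for every $x \in G$ there is a representation $x + H = \sum_{i=1}^s f_i(a_i + H)$ of $x+H$ with $f_i \in [0,|S_i|]$ for all $i$, $f_1+\dots+f_s > 0$, and $f_1 \in [2, |S_1| - 2]$.
   Context: Setting: $G$ is a cyclic group of order $pq$, where $p,q$ are primes with $p + \lfloor 2\sqrt{p-2}\rfloor + 1 < q < 2p$; $S \subset G \setminus \{0\}$ is a subset with $|S| = p+q-2$; $H \subset G$ is the subgroup of index $p$. Let $s$ be the number of cosets $a + H$ with $a \in S \setminus H$, and choose $a_1,\dots,a_s \in S \setminus H$ lying in pairwise distinct cosets of $H$. Set $S_0 = H \cap S$ and $S_i = (a_i + H) \cap S$ for $i \in [1,s]$. The $a_i$ are indexed, with $t,r,u \in \mathbb{N}_0$, $t+r+u = s$, so that $|S_1| \ge \dots \ge |S_t| \ge 3$, $|S_{t+1}| = \dots = |S_{t+r}| = 1$, and $|S_{t+r+1}| = \dots = |S_{t+r+u}| = 2$. Here $[a,b] = \{x \in \mathbb{Z} : a \le x \le b\}$. -}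

module Defs where

open import Data.Nat using (ℕ; zero; suc; _+_; _*_; _≤?_)
import Data.Nat.Divisibility as ℕD
open import Data.Integer using (ℤ; +_; _-_; ∣_∣)
open import Data.Integer.Divisibility using (_∣_)
open import Data.List using (List; filter; length)
open import Relation.Nullary using (Dec; yes; no; ¬?)

isqrtAux : ℕ → ℕ → ℕ
isqrtAux n zero = zero
isqrtAux n (suc k) with suc k * suc k ≤? n
... | yes _ = suc k
... | no _ = isqrtAux n k

isqrt : ℕ → ℕ
isqrt n = isqrtAux n n

-- ⌊2√m⌋ = ⌊√(4m)⌋
floor2sqrt : ℕ → ℕ
floor2sqrt m = isqrt (4 * m)

-- G = ℤ/(pq)ℤ with elements represented by 0 ≤ x < p*q.
-- H = the subgroup of index p = { x ∈ G | p ∣ x } (of order q).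
InH : ℕ → ℕ → Set
InH p x = (+ p) ∣ (+ x)

InH? : (p x : ℕ) → Dec (InH p x)
InH? p x = p ℕD.∣? x

-- x + H = y + H  ⇔  x - y ∈ H  ⇔  p ∣ (x - y)  (as p ∣ pq, this is independent of representatives)
SameCoset : ℕ → ℕ → ℕ → Set
SameCoset p x y = (+ p) ∣ (+ x - + y)

SameCoset? : (p x y : ℕ) → Dec (SameCoset p x y)
SameCoset? p x y = p ℕD.∣? ∣ + x - + y ∣

sizeS0 : ℕ → List ℕ → ℕ
sizeS0 p S = length (filter (InH? p) S)

cosetSize : ℕ → List ℕ → ℕ → ℕ
cosetSize p S a = length (filter (SameCoset? p a) S)

sumTo : ℕ → (ℕ → ℕ) → ℕ
sumTo zero g = zero
sumTo (suc n) g = sumTo n g + g (suc n)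

module Submission where

open import Defs

-- Pass to the quotient G/H ≅ ℤ/pℤ, where a coset x + H is
-- represented by the residue x mod p.  Every a_i lies outside H, i.e. is a
-- unit of ℤ/pℤ (p is prime).  For a unit d, repeatedly adding d walks
-- around all of ℤ/pℤ, so a set A ⊆ ℤ/pℤ that is neither empty nor full has
-- |A ∪ (A + d)| > |A|; iterating, |A + {0,…,j}·d| ≥ min(|A| + j, p)
-- (Cauchy–Davenport for arithmetic progressions).  Starting from {2a₁} and
-- adding the progressions {0,…,|S₁|−4}·a₁ and {0,…,|S_i|}·a_i (i ≥ 2) we
-- reach at least min(Σ_i |S_i| − 3, p) residues, and Σ_i |S_i| ≥ p + 3
-- because |S| = p + q − 2, |S₀| ≤ 2 and q ≥ 7.  Hence every residue is
-- reached, which is the required representation with f₁ ∈ [2, |S₁| − 2].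

open import Data.Bool using (Bool; true; false; T; _∨_; if_then_else_)
open import Data.Bool.Properties using (T-∨)
open import Data.Empty using (⊥-elim)
import Data.Integer as ℤ
open import Data.Integer using () renaming (+_ to toℤ)
open import Data.Integer.Divisibility.Signed using (divides; ∣⇒∣ᵤ)
import Data.Integer.Properties as ℤ
import Data.Integer.Tactic.RingSolver as ℤ-Solver
open import Data.List using (List; []; _∷_; length; filter)
open import Data.List.Properties using (filter-accept)
open import Data.List.Membership.Propositional using (_∈_)
open import Data.List.Relation.Unary.All using (All)
open import Data.List.Relation.Unary.Any using (here; there)
open import Data.List.Relation.Unary.Unique.Propositional using (Unique)
open import Data.Nat
open import Data.Nat.Coprimality using (prime⇒coprime; coprime-Bézout)
open import Data.Nat.Divisibility using (_∣_; m%n≡0⇒n∣m)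
open import Data.Nat.DivMod
open import Data.Nat.GCD using (module Bézout)
open import Data.Nat.Primality using (Prime; prime⇒nonZero; prime⇒nonTrivial)
open import Data.Nat.Properties
open import Algebra.Properties.CommutativeSemigroup +-commutativeSemigroup using (xy∙z≈xz∙y)
open import Data.Nat.Tactic.RingSolver using (solve-∀)
open import Data.Product using (Σ; ∃-syntax; _×_; _,_; proj₂)
open import Data.Sum using (_⊎_; inj₁; inj₂)
open import Function using (_∘_; Equivalence)
open import Relation.Binary.PropositionalEquality
open import Relation.Nullary using (¬_; yes; no; does)
open import Relation.Nullary.Decidable using (T?; dec-true; dec-false)
open import Relation.Unary using (Decidable)

sumTo-mono : ∀ k (g h : ℕ → ℕ) → (∀ i → 1 ≤ i → i ≤ k → g i ≤ h i) → sumTo k g ≤ sumTo k h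
sumTo-mono zero    g h g≤h = z≤n
sumTo-mono (suc k) g h g≤h =
  +-mono-≤ (sumTo-mono k g h (λ i 1≤i i≤k → g≤h i 1≤i (m≤n⇒m≤1+n i≤k))) (g≤h (suc k) (s≤s z≤n) ≤-refl)

sumTo-strict : ∀ k (g h : ℕ → ℕ) → (∀ i → 1 ≤ i → i ≤ k → g i ≤ h i)
  → ∀ j → 1 ≤ j → j ≤ k → g j < h j → sumTo k g < sumTo k h
sumTo-strict zero    g h g≤h (suc j) 1≤j () gj<hj
sumTo-strict (suc k) g h g≤h j 1≤j j≤1+k gj<hj with m≤n⇒m<n∨m≡n j≤1+k
... | inj₁ (s≤s j≤k) =
  +-mono-<-≤ (sumTo-strict k g h (λ i 1≤i i≤k → g≤h i 1≤i (m≤n⇒m≤1+n i≤k)) j 1≤j j≤k gj<hj)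
             (g≤h (suc k) (s≤s z≤n) ≤-refl)
... | inj₂ refl = +-mono-≤-< (sumTo-mono k g h (λ i 1≤i i≤k → g≤h i 1≤i (m≤n⇒m≤1+n i≤k))) gj<hj

sumTo-ext : ∀ k (g h : ℕ → ℕ) → (∀ i → 1 ≤ i → i ≤ k → g i ≡ h i) → sumTo k g ≡ sumTo k h
sumTo-ext zero    g h g≡h = refl
sumTo-ext (suc k) g h g≡h =
  cong₂ _+_ (sumTo-ext k g h (λ i 1≤i i≤k → g≡h i 1≤i (m≤n⇒m≤1+n i≤k))) (g≡h (suc k) (s≤s z≤n) ≤-refl)

first≤sumTo : ∀ k (g : ℕ → ℕ) → 1 ≤ k → g 1 ≤ sumTo k g
first≤sumTo (suc zero)    g _ = ≤-refl
first≤sumTo (suc (suc k)) g _ = ≤-trans (first≤sumTo (suc k) g (s≤s z≤n)) (m≤m+n _ _)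

sumTo-replace-first : ∀ k (g h : ℕ → ℕ) → 1 ≤ k → (∀ i → 2 ≤ i → g i ≡ h i)
  → sumTo k g + h 1 ≡ sumTo k h + g 1
sumTo-replace-first (suc zero)    g h _ _   = +-comm (g 1) (h 1)
sumTo-replace-first (suc (suc k)) g h _ g≡h = begin
  sumTo (suc k) g + g K + h 1 ≡⟨ xy∙z≈xz∙y (sumTo (suc k) g) (g K) (h 1) ⟩
  sumTo (suc k) g + h 1 + g K ≡⟨ cong₂ _+_ (sumTo-replace-first (suc k) g h (s≤s z≤n) g≡h) (g≡h K (s≤s (s≤s z≤n))) ⟩
  sumTo (suc k) h + g 1 + h K ≡⟨ xy∙z≈xz∙y (sumTo (suc k) h) (g 1) (h K) ⟩
  sumTo (suc k) h + h K + g 1 ∎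
  where
  open ≡-Reasoning
  K = suc (suc k)

sumTo-pos⇒range-pos : ∀ k (g : ℕ → ℕ) → 1 ≤ sumTo k g → 1 ≤ k
sumTo-pos⇒range-pos (suc k) g _ = s≤s z≤n

update : (ℕ → ℕ) → ℕ → ℕ → ℕ → ℕ
update g k v i = if does (i ≟ k) then v else g i

update-same : ∀ (g : ℕ → ℕ) k v → update g k v k ≡ v
update-same g k v rewrite dec-true (k ≟ k) refl = refl

update-other : ∀ (g : ℕ → ℕ) k v i → i ≢ k → update g k v i ≡ g i
update-other g k v i i≢k rewrite dec-false (i ≟ k) i≢k = refl

indicator : Bool → ℕ
indicator true  = 1
indicator false = 0

count : (ℕ → Bool) → ℕ → ℕ
count A zero    = 0
count A (suc n) = count A n + indicator (A n)

indicator-true : ∀ {b} → T b → indicator b ≡ 1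
indicator-true {true} _ = refl

indicator-false : ∀ {b} → ¬ T b → indicator b ≡ 0
indicator-false {false} _   = refl
indicator-false {true}  ¬tt = ⊥-elim (¬tt _)

indicator-mono : ∀ {a b} → (T a → T b) → indicator a ≤ indicator b
indicator-mono {false}         _   = z≤n
indicator-mono {true} {true}  _   = ≤-refl
indicator-mono {true} {false} a⇒b = ⊥-elim (a⇒b _)

_⊆_below_ : (ℕ → Bool) → (ℕ → Bool) → ℕ → Set
A ⊆ B below n = ∀ z → z < n → T (A z) → T (B z)

⊆-below-pred : ∀ {A B n} → A ⊆ B below suc n → A ⊆ B below n
⊆-below-pred A⊆B z z<n = A⊆B z (m<n⇒m<1+n z<n)

count-mono : ∀ (A B : ℕ → Bool) n → A ⊆ B below n → count A n ≤ count B n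
count-mono A B zero    _   = z≤n
count-mono A B (suc n) A⊆B =
  +-mono-≤ (count-mono A B n (⊆-below-pred A⊆B)) (indicator-mono (A⊆B n ≤-refl))

count-strict : ∀ (A B : ℕ → Bool) n → A ⊆ B below n → ∀ w → w < n → ¬ T (A w) → T (B w) → count A n < count B n
count-strict A B (suc n) A⊆B w w<1+n ¬Aw Bw with m<1+n⇒m<n∨m≡n w<1+n
... | inj₁ w<n = +-mono-<-≤ (count-strict A B n (⊆-below-pred A⊆B) w w<n ¬Aw Bw) (indicator-mono (A⊆B n ≤-refl))
... | inj₂ refl = subst₂ (λ x y → count A w + x < count B w + y)
  (sym (indicator-false ¬Aw)) (sym (indicator-true Bw))
  (+-mono-≤-< (count-mono A B w (⊆-below-pred A⊆B)) (s≤s z≤n))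

count-everything : ∀ n → count (λ _ → true) n ≡ n
count-everything zero    = refl
count-everything (suc n) = trans (cong (_+ 1) (count-everything n)) (+-comm n 1)

missing⇒count< : ∀ (A : ℕ → Bool) n w → w < n → ¬ T (A w) → count A n < n
missing⇒count< A n w w<n ¬Aw = subst (count A n <_) (count-everything n)
  (count-strict A (λ _ → true) n (λ _ _ _ → _) w w<n ¬Aw _)

count-full : ∀ (A : ℕ → Bool) n → n ≤ count A n → ∀ z → z < n → T (A z)
count-full A n n≤count z z<n with T? (A z)
... | yes Az = Az
... | no ¬Az = ⊥-elim (<⇒≱ (missing⇒count< A n z z<n ¬Az) n≤count)

count<⇒missing : ∀ (A : ℕ → Bool) n → count A n < n → ∃[ z ] z < n × ¬ T (A z)
count<⇒missing A (suc n) count< with T? (A n)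
... | no ¬An = n , ≤-refl , ¬An
... | yes An = let z , z<n , ¬Az = count<⇒missing A n count<n in z , m<n⇒m<1+n z<n , ¬Az
  where
  count<n : count A n < n
  count<n = ≤-pred (subst (_< suc n) (trans (cong (count A n +_) (indicator-true An)) (+-comm (count A n) 1)) count<)

first-exit : (P : ℕ → Bool) → ∀ k → T (P 0) → ¬ T (P k) → ∃[ j ] T (P j) × ¬ T (P (suc j))
first-exit P zero    P0 ¬P0 = ⊥-elim (¬P0 P0)
first-exit P (suc k) P0 ¬Pk+1 with T? (P k)
... | yes Pk  = k , Pk , ¬Pk+1
... | no  ¬Pk = first-exit P k P0 ¬Pk

member⇒count-pos : ∀ (A : ℕ → Bool) n w → w < n → T (A w) → 1 ≤ count A n
member⇒count-pos A (suc n) w w<1+n Aw with m<1+n⇒m<n∨m≡n w<1+n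
... | inj₁ w<n  = ≤-trans (member⇒count-pos A n w w<n Aw) (m≤m+n _ _)
... | inj₂ refl = ≤-trans (≤-reflexive (sym (indicator-true Aw))) (m≤n+m _ _)

-- Modular inverses: modulo a prime p, every d with p ∤ d is invertible
-- (from a Bézout identity for p and d mod p).
modular-inverse : ∀ p .{{_ : NonZero p}} → Prime p → ∀ d → ¬ p ∣ d → ∃[ k ] (k * d) % p ≡ 1
modular-inverse p@(suc m) pr d p∤d = from-Bézout (coprime-Bézout (prime⇒coprime pr (m%n<n d p)))
  where
  r = d % p
  instance
    r-nonZero : NonZero r
    r-nonZero = ≢-nonZero (λ r≡0 → p∤d (m%n≡0⇒n∣m d p r≡0))

  one-reduced : 1 % p ≡ 1
  one-reduced = m<n⇒m%n≡m (nonTrivial⇒n>1 p {{prime⇒nonTrivial pr}})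

  reduce : ∀ k → (k * d) % p ≡ (k * r) % p
  reduce k = begin
    (k * d) % p             ≡⟨ %-distribˡ-* k d p ⟩
    (k % p * (d % p)) % p   ≡⟨ cong (λ t → (k % p * t) % p) (m%n%n≡m%n d p) ⟨
    (k % p * (r % p)) % p   ≡⟨ %-distribˡ-* k r p ⟨
    (k * r) % p             ∎
    where open ≡-Reasoning

  from-Bézout : Bézout.Identity 1 p r → ∃[ k ] (k * d) % p ≡ 1
  -- 1 + x * p = y * r : y is an inverse.
  from-Bézout (Bézout.-+ x y eq) = y , (begin
    (y * d) % p       ≡⟨ reduce y ⟩
    (y * r) % p       ≡⟨ cong (_% p) eq ⟨
    (1 + x * p) % p   ≡⟨ [m+kn]%n≡m%n 1 x p ⟩
    1 % p             ≡⟨ one-reduced ⟩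
    1                 ∎)
    where open ≡-Reasoning
  -- 1 + y * r = x * p : y * r ≡ -1, so y * (p - 1) = y * m is an inverse.
  from-Bézout (Bézout.+- x y eq) = y * m , (begin
    (y * m * d) % p                     ≡⟨ reduce (y * m) ⟩
    (y * m * r) % p                     ≡⟨ [m+kn]%n≡m%n (y * m * r) x p ⟨
    (y * m * r + x * p) % p             ≡⟨ cong (λ t → (y * m * r + t) % p) eq ⟨
    (y * m * r + (1 + y * r)) % p       ≡⟨ cong (_% p) (regroup y m r) ⟩
    (1 + (y * r) * p) % p               ≡⟨ [m+kn]%n≡m%n 1 (y * r) p ⟩
    1 % p                               ≡⟨ one-reduced ⟩
    1                                   ∎)
    where
    open ≡-Reasoning
    regroup : ∀ y m r → y * m * r + (1 + y * r) ≡ 1 + (y * r) * suc m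
    regroup = solve-∀

-- Residues modulo a fixed modulus p, and sets of residues (sets of
-- naturals of which only the members below p matter).
module Residues (p : ℕ) .{{_ : NonZero p}} where

  %-absorbˡ : ∀ a b → (a % p + b) % p ≡ (a + b) % p
  %-absorbˡ a b = begin
    (a % p + b) % p           ≡⟨ %-distribˡ-+ (a % p) b p ⟩
    (a % p % p + b % p) % p   ≡⟨ cong (λ t → (t + b % p) % p) (m%n%n≡m%n a p) ⟩
    (a % p + b % p) % p       ≡⟨ %-distribˡ-+ a b p ⟨
    (a + b) % p               ∎
    where open ≡-Reasoning

  %-absorbʳ : ∀ a b → (a + b % p) % p ≡ (a + b) % p
  %-absorbʳ a b = begin
    (a + b % p) % p   ≡⟨ cong (_% p) (+-comm a (b % p)) ⟩
    (b % p + a) % p   ≡⟨ %-absorbˡ b a ⟩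
    (b + a) % p       ≡⟨ cong (_% p) (+-comm b a) ⟩
    (a + b) % p       ∎
    where open ≡-Reasoning

  *-%-absorbʳ : ∀ a b → (a * (b % p)) % p ≡ (a * b) % p
  *-%-absorbʳ a b = begin
    (a * (b % p)) % p           ≡⟨ %-distribˡ-* a (b % p) p ⟩
    (a % p * (b % p % p)) % p   ≡⟨ cong (λ t → (a % p * t) % p) (m%n%n≡m%n b p) ⟩
    (a % p * (b % p)) % p       ≡⟨ %-distribˡ-* a b p ⟨
    (a * b) % p                 ∎
    where open ≡-Reasoning

  Unit : ℕ → Set
  Unit d = ∃[ k ] (k * d) % p ≡ 1

  -- Repeatedly adding a unit d leads from any residue y to any residue z:
  -- take k = (z - y) · d⁻¹.
  orbit : ∀ {d} → Unit d → ∀ y z → y < p → z < p → ∃[ k ] (y + k * d) % p ≡ z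
  orbit {d} (k₀ , k₀d≡1) y z y<p z<p = (z + (p ∸ y)) * k₀ , (begin
    (y + (z + (p ∸ y)) * k₀ * d) % p               ≡⟨ cong (λ t → (y + t) % p) (*-assoc (z + (p ∸ y)) k₀ d) ⟩
    (y + (z + (p ∸ y)) * (k₀ * d)) % p             ≡⟨ %-absorbʳ y _ ⟨
    (y + ((z + (p ∸ y)) * (k₀ * d)) % p) % p       ≡⟨ cong (λ t → (y + t) % p) (*-%-absorbʳ (z + (p ∸ y)) (k₀ * d)) ⟨
    (y + ((z + (p ∸ y)) * ((k₀ * d) % p)) % p) % p ≡⟨ cong (λ t → (y + ((z + (p ∸ y)) * t) % p) % p) k₀d≡1 ⟩
    (y + ((z + (p ∸ y)) * 1) % p) % p              ≡⟨ %-absorbʳ y _ ⟩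
    (y + (z + (p ∸ y)) * 1) % p                    ≡⟨ cong (_% p) (regroup y z (p ∸ y)) ⟩
    (z + (p ∸ y + y)) % p                          ≡⟨ cong (λ t → (z + t) % p) (m∸n+n≡m (<⇒≤ y<p)) ⟩
    (z + p) % p                                    ≡⟨ [m+n]%n≡m%n z p ⟩
    z % p                                          ≡⟨ m<n⇒m%n≡m z<p ⟩
    z                                              ∎)
    where
    open ≡-Reasoning
    regroup : ∀ y z t → y + (z + t) * 1 ≡ z + (t + y)
    regroup = solve-∀

  negate : ℕ → ℕ
  negate d = p ∸ d % p

  +-negate : ∀ x d → (x + d + negate d) % p ≡ x % p
  +-negate x d = begin
    (x + d + negate d) % p                         ≡⟨ cong (λ t → (x + t + negate d) % p) (m≡m%n+[m/n]*n d p) ⟩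
    (x + (d % p + d / p * p) + (p ∸ d % p)) % p    ≡⟨ cong (_% p) (regroup x (d % p) (d / p * p) (p ∸ d % p)) ⟩
    (x + d / p * p + (d % p + (p ∸ d % p))) % p    ≡⟨ cong (λ t → (x + d / p * p + t) % p) (m+[n∸m]≡n (m%n≤n d p)) ⟩
    (x + d / p * p + p) % p                        ≡⟨ [m+n]%n≡m%n (x + d / p * p) p ⟩
    (x + d / p * p) % p                            ≡⟨ [m+kn]%n≡m%n x (d / p) p ⟩
    x % p                                          ∎
    where
    open ≡-Reasoning
    regroup : ∀ x r q t → x + (r + q) + t ≡ x + q + (r + t)
    regroup = solve-∀

  -- A ∪ (A + d): z is a member when z or z - d lies in A.
  extend : ℕ → (ℕ → Bool) → ℕ → Bool
  extend d A z = A z ∨ A ((z + negate d) % p)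

  extend-⊇ : ∀ d (A : ℕ → Bool) z → T (A z) → T (extend d A z)
  extend-⊇ d A z Az = Equivalence.from T-∨ (inj₁ Az)

  extend-hit : ∀ d (A : ℕ → Bool) w → w < p → T (A w) → T (extend d A ((w + d) % p))
  extend-hit d A w w<p Aw = Equivalence.from T-∨ (inj₂ (subst (T ∘ A) (sym back) Aw))
    where
    back : ((w + d) % p + negate d) % p ≡ w
    back = trans (%-absorbˡ (w + d) (negate d)) (trans (+-negate w d) (m<n⇒m%n≡m w<p))

  extend-sound : ∀ d (A : ℕ → Bool) z → T (extend d A z) → T (A z) ⊎ ∃[ y ] T (A y) × (y + d) % p ≡ z % p
  extend-sound d A z z∈ext with Equivalence.to T-∨ z∈ext
  ... | inj₁ Az = inj₁ Az
  ... | inj₂ Ay = inj₂ (_ , Ay , (begin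
    ((z + negate d) % p + d) % p   ≡⟨ %-absorbˡ (z + negate d) d ⟩
    (z + negate d + d) % p         ≡⟨ cong (_% p) (xy∙z≈xz∙y z (negate d) d) ⟩
    (z + d + negate d) % p         ≡⟨ +-negate z d ⟩
    z % p                          ∎))
    where open ≡-Reasoning

  -- Walking from a member y to a non-member z
  -- along y, y + d, y + 2d, … we find a member w with w + d ∉ A.
  extend-grows : ∀ {d} → Unit d → ∀ (A : ℕ → Bool) y z → y < p → T (A y) → z < p → ¬ T (A z)
    → count A p < count (extend d A) p
  extend-grows {d} unit A y z y<p Ay z<p ¬Az =
    let k , walk-k≡z = orbit unit y z y<p z<p
        j , in-j , out-next = first-exit (A ∘ walk) k start (subst (λ t → ¬ T (A t)) (sym walk-k≡z) ¬Az)
    in count-strict A (extend d A) p (λ z _ → extend-⊇ d A z) (walk (suc j)) (m%n<n _ p) out-next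
         (subst (T ∘ extend d A) (walk-step j) (extend-hit d A (walk j) (m%n<n _ p) in-j))
    where
    walk : ℕ → ℕ
    walk j = (y + j * d) % p

    start : T (A (walk 0))
    start = subst (T ∘ A) (sym (trans (cong (_% p) (+-identityʳ y)) (m<n⇒m%n≡m y<p))) Ay

    walk-step : ∀ j → (walk j + d) % p ≡ walk (suc j)
    walk-step j = trans (%-absorbˡ (y + j * d) d) (cong (_% p) (regroup y j d))
      where
      regroup : ∀ y j d → y + j * d + d ≡ y + (d + j * d)
      regroup = solve-∀

  -- A + {0, 1, …, j}·d
  progression : ℕ → ℕ → (ℕ → Bool) → ℕ → Bool
  progression d zero    A = A
  progression d (suc j) A = extend d (progression d j A)

  progression-⊇ : ∀ d j (A : ℕ → Bool) z → T (A z) → T (progression d j A z)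
  progression-⊇ d zero    A z Az = Az
  progression-⊇ d (suc j) A z Az = extend-⊇ d (progression d j A) z (progression-⊇ d j A z Az)

  progression-sound : ∀ d j (A : ℕ → Bool) z → T (progression d j A z)
    → ∃[ c ] c ≤ j × ∃[ y ] T (A y) × (y + c * d) % p ≡ z % p
  progression-sound d zero    A z Az = 0 , z≤n , z , Az , cong (_% p) (+-identityʳ z)
  progression-sound d (suc j) A z z∈P with extend-sound d (progression d j A) z z∈P
  ... | inj₁ z∈P′ =
    let c , c≤j , y , Ay , y+cd≡z = progression-sound d j A z z∈P′
    in c , m≤n⇒m≤1+n c≤j , y , Ay , y+cd≡z
  ... | inj₂ (y′ , y′∈P′ , y′+d≡z) =
    let c , c≤j , y , Ay , y+cd≡y′ = progression-sound d j A y′ y′∈P′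
    in suc c , s≤s c≤j , y , Ay , (begin
      (y + (d + c * d)) % p       ≡⟨ cong (_% p) (regroup y c d) ⟩
      (y + c * d + d) % p         ≡⟨ %-absorbˡ (y + c * d) d ⟨
      ((y + c * d) % p + d) % p   ≡⟨ cong (λ t → (t + d) % p) y+cd≡y′ ⟩
      (y′ % p + d) % p            ≡⟨ %-absorbˡ y′ d ⟩
      (y′ + d) % p                ≡⟨ y′+d≡z ⟩
      z % p                       ∎)
    where
    open ≡-Reasoning
    regroup : ∀ y c d → y + (d + c * d) ≡ y + c * d + d
    regroup = solve-∀

  extend-size : ∀ {d} → Unit d → ∀ (A : ℕ → Bool) y → y < p → T (A y) → ∀ n
    → n ⊓ p ≤ count A p → suc n ⊓ p ≤ count (extend d A) p
  extend-size {d} unit A y y<p Ay n n⊓p≤|A| with count A p <? p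
  ... | yes |A|<p = let z , z<p , ¬Az = count<⇒missing A p |A|<p in begin
    suc n ⊓ p         ≤⟨ ⊓-monoʳ-≤ (suc n) (n≤1+n p) ⟩
    suc (n ⊓ p)       ≤⟨ s≤s n⊓p≤|A| ⟩
    suc (count A p)   ≤⟨ extend-grows unit A y z y<p Ay z<p ¬Az ⟩
    count (extend d A) p ∎
    where open ≤-Reasoning
  ... | no |A|≮p = begin
    suc n ⊓ p            ≤⟨ m⊓n≤n (suc n) p ⟩
    p                    ≤⟨ ≮⇒≥ |A|≮p ⟩
    count A p            ≤⟨ count-mono A (extend d A) p (λ z _ → extend-⊇ d A z) ⟩
    count (extend d A) p ∎
    where open ≤-Reasoning

  progression-size : ∀ {d} → Unit d → ∀ (A : ℕ → Bool) y → y < p → T (A y) → ∀ m j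
    → m ⊓ p ≤ count A p → (m + j) ⊓ p ≤ count (progression d j A) p
  progression-size unit A y y<p Ay m zero m⊓p≤|A| =
    subst (λ t → t ⊓ p ≤ count A p) (sym (+-identityʳ m)) m⊓p≤|A|
  progression-size {d} unit A y y<p Ay m (suc j) m⊓p≤|A| =
    subst (λ t → t ⊓ p ≤ count (progression d (suc j) A) p) (sym (+-suc m j))
      (extend-size unit (progression d j A) y y<p (progression-⊇ d j A y Ay) (m + j)
        (progression-size unit A y y<p Ay m j m⊓p≤|A|))

  -- The residues  v + Σ_{i=1}^{k} g_i·d_i  with 0 ≤ g_i ≤ len_i.
  reachable : ℕ → (d len : ℕ → ℕ) → ℕ → ℕ → Bool
  reachable v d len zero    z = z ≡ᵇ v % p
  reachable v d len (suc k)   = progression (d (suc k)) (len (suc k)) (reachable v d len k)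

  reachable-start : ∀ v (d len : ℕ → ℕ) k → T (reachable v d len k (v % p))
  reachable-start v d len zero    = ≡⇒≡ᵇ (v % p) (v % p) refl
  reachable-start v d len (suc k) =
    progression-⊇ (d (suc k)) (len (suc k)) (reachable v d len k) (v % p) (reachable-start v d len k)

  reachable-sound : ∀ v (d len : ℕ → ℕ) k z → T (reachable v d len k z)
    → ∃[ g ] (∀ i → 1 ≤ i → i ≤ k → g i ≤ len i) × (v + sumTo k (λ i → g i * d i)) % p ≡ z % p
  reachable-sound v d len zero z z≡v =
    (λ _ → 0) , (λ { i (s≤s _) () }) , (begin
      (v + 0) % p   ≡⟨ cong (_% p) (+-identityʳ v) ⟩
      v % p         ≡⟨ m%n%n≡m%n v p ⟨
      v % p % p     ≡⟨ cong (_% p) (≡ᵇ⇒≡ z (v % p) z≡v) ⟨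
      z % p         ∎)
    where open ≡-Reasoning
  reachable-sound v d len (suc k) z z∈R =
    let c , c≤len , y , y∈R , y+cd≡z = progression-sound (d K) (len K) (reachable v d len k) z z∈R
        g , g≤len , v+Σ≡y = reachable-sound v d len k y y∈R
        g′ = update g K c
        Σ′≡Σ = sumTo-ext k (λ i → g′ i * d i) (λ i → g i * d i)
                 (λ i _ i≤k → cong (_* d i) (update-other g K c i (<⇒≢ (s≤s i≤k))))
    in g′ , bounds g g≤len c c≤len , (begin
      (v + (sumTo k (λ i → g′ i * d i) + g′ K * d K)) % p
        ≡⟨ cong₂ (λ s t → (v + (s + t * d K)) % p) Σ′≡Σ (update-same g K c) ⟩
      (v + (sumTo k (λ i → g i * d i) + c * d K)) % p
        ≡⟨ cong (_% p) (+-assoc v _ (c * d K)) ⟨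
      (v + sumTo k (λ i → g i * d i) + c * d K) % p
        ≡⟨ %-absorbˡ _ (c * d K) ⟨
      ((v + sumTo k (λ i → g i * d i)) % p + c * d K) % p
        ≡⟨ cong (λ t → (t + c * d K) % p) v+Σ≡y ⟩
      (y % p + c * d K) % p
        ≡⟨ %-absorbˡ y (c * d K) ⟩
      (y + c * d K) % p
        ≡⟨ y+cd≡z ⟩
      z % p ∎)
    where
    open ≡-Reasoning
    K = suc k

    bounds : ∀ (g : ℕ → ℕ) → (∀ i → 1 ≤ i → i ≤ k → g i ≤ len i) → ∀ c → c ≤ len K
      → ∀ i → 1 ≤ i → i ≤ K → update g K c i ≤ len i
    bounds g g≤len c c≤len i 1≤i i≤K with m≤n⇒m<n∨m≡n i≤K
    ... | inj₁ (s≤s i≤k) = subst (_≤ len i) (sym (update-other g K c i (<⇒≢ (s≤s i≤k)))) (g≤len i 1≤i i≤k)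
    ... | inj₂ refl      = subst (_≤ len K) (sym (update-same g K c)) c≤len

  reachable-size : ∀ v (d len : ℕ → ℕ) k → (∀ i → 1 ≤ i → i ≤ k → Unit (d i))
    → (1 + sumTo k len) ⊓ p ≤ count (reachable v d len k) p
  reachable-size v d len zero    _     =
    ≤-trans (m⊓n≤m 1 p) (member⇒count-pos _ p (v % p) (m%n<n v p) (reachable-start v d len 0))
  reachable-size v d len (suc k) units =
    progression-size (units (suc k) (s≤s z≤n) ≤-refl) (reachable v d len k) (v % p) (m%n<n v p)
      (reachable-start v d len k) (1 + sumTo k len) (len (suc k))
      (reachable-size v d len k (λ i 1≤i i≤k → units i 1≤i (m≤n⇒m≤1+n i≤k)))

  progression-sums-cover : ∀ v (d len : ℕ → ℕ) k → (∀ i → 1 ≤ i → i ≤ k → Unit (d i))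
    → p ≤ 1 + sumTo k len
    → ∀ z → ∃[ g ] (∀ i → 1 ≤ i → i ≤ k → g i ≤ len i) × (v + sumTo k (λ i → g i * d i)) % p ≡ z % p
  progression-sums-cover v d len k units p≤budget z =
    let g , g≤len , v+Σ≡z = reachable-sound v d len k (z % p) (count-full _ p full (z % p) (m%n<n z p))
    in g , g≤len , trans v+Σ≡z (m%n%n≡m%n z p)
    where
    full : p ≤ count (reachable v d len k) p
    full = subst (_≤ count (reachable v d len k) p) (m≥n⇒m⊓n≡n p≤budget) (reachable-size v d len k units)

same-residue⇒SameCoset : ∀ p .{{_ : NonZero p}} x y → x % p ≡ y % p → SameCoset p x y
same-residue⇒SameCoset p x y x≡y = ∣⇒∣ᵤ (divides (X ℤ.- Y) (begin
  toℤ x ℤ.- toℤ y                                  ≡⟨ cong₂ ℤ._-_ (lift x) (lift y) ⟩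
  (toℤ (x % p) ℤ.+ X ℤ.* P) ℤ.- (toℤ (y % p) ℤ.+ Y ℤ.* P)
    ≡⟨ cong (λ r → (toℤ (x % p) ℤ.+ X ℤ.* P) ℤ.- (toℤ r ℤ.+ Y ℤ.* P)) x≡y ⟨
  (toℤ (x % p) ℤ.+ X ℤ.* P) ℤ.- (toℤ (x % p) ℤ.+ Y ℤ.* P)
    ≡⟨ cancel (toℤ (x % p)) X Y P ⟩
  (X ℤ.- Y) ℤ.* P                                  ∎))
  where
  open ≡-Reasoning
  X = toℤ (x / p)
  Y = toℤ (y / p)
  P = toℤ p

  lift : ∀ z → toℤ z ≡ toℤ (z % p) ℤ.+ toℤ (z / p) ℤ.* P
  lift z = begin
    toℤ z                                 ≡⟨ cong toℤ (m≡m%n+[m/n]*n z p) ⟩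
    toℤ (z % p + z / p * p)               ≡⟨ ℤ.pos-+ (z % p) (z / p * p) ⟩
    toℤ (z % p) ℤ.+ toℤ (z / p * p)       ≡⟨ cong (λ t → toℤ (z % p) ℤ.+ t) (ℤ.pos-* (z / p) p) ⟩
    toℤ (z % p) ℤ.+ toℤ (z / p) ℤ.* P     ∎

  cancel : ∀ r a b n → (r ℤ.+ a ℤ.* n) ℤ.- (r ℤ.+ b ℤ.* n) ≡ (a ℤ.- b) ℤ.* n
  cancel = ℤ-Solver.solve-∀

SameCoset-sym : ∀ p x y → SameCoset p x y → SameCoset p y x
SameCoset-sym p x y = subst (p ∣_) (ℤ.∣i-j∣≡∣j-i∣ (toℤ x) (toℤ y))

length-filter-∷ : ∀ {A : Set} {P : A → Set} (P? : Decidable P) b L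
  → length (filter P? L) ≤ length (filter P? (b ∷ L))
length-filter-∷ P? b L with does (P? b)
... | true  = n≤1+n _
... | false = ≤-refl

module _ {A : Set} {P : A → Set} (P? : Decidable P)
         {Q : ℕ → A → Set} (Q? : ∀ i → Decidable (Q i)) (s : ℕ) where

  #P : List A → ℕ
  #P L = length (filter P? L)

  #Q : List A → ℕ
  #Q L = sumTo s (λ i → length (filter (Q? i) L))

  length-≤-cover : ∀ L → (∀ b → b ∈ L → P b ⊎ ∃[ i ] 1 ≤ i × i ≤ s × Q i b)
    → length L ≤ #P L + #Q L
  length-≤-cover []      _       = z≤n
  length-≤-cover (b ∷ L) covered with covered b (here refl)
  ... | inj₁ Pb = begin
    suc (length L)            ≤⟨ s≤s (length-≤-cover L (λ c c∈L → covered c (there c∈L))) ⟩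
    suc (#P L) + #Q L         ≡⟨ cong (λ L′ → length L′ + #Q L) (filter-accept P? Pb) ⟨
    #P (b ∷ L) + #Q L         ≤⟨ +-monoʳ-≤ (#P (b ∷ L)) (sumTo-mono s _ _ (λ i _ _ → length-filter-∷ (Q? i) b L)) ⟩
    #P (b ∷ L) + #Q (b ∷ L)   ∎
    where open ≤-Reasoning
  ... | inj₂ (i , 1≤i , i≤s , Qib) = begin
    suc (length L)            ≤⟨ s≤s (length-≤-cover L (λ c c∈L → covered c (there c∈L))) ⟩
    suc (#P L + #Q L)         ≡⟨ +-suc (#P L) (#Q L) ⟨
    #P L + suc (#Q L)         ≤⟨ +-mono-≤ (length-filter-∷ P? b L)
                                   (sumTo-strict s _ _ (λ j _ _ → length-filter-∷ (Q? j) b L) i 1≤i i≤s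
                                     (≤-reflexive (cong length (sym (filter-accept (Q? i) Qib))))) ⟩
    #P (b ∷ L) + #Q (b ∷ L)   ∎
    where open ≤-Reasoning

isqrtAux-pos : ∀ n k → 1 ≤ n → 1 ≤ k → 1 ≤ isqrtAux n k
isqrtAux-pos n (suc k) 1≤n _ with suc k * suc k ≤? n
... | yes _ = s≤s z≤n
... | no k²≰n with k
...   | zero   = ⊥-elim (k²≰n 1≤n)
...   | suc k′ = isqrtAux-pos n (suc k′) 1≤n (s≤s z≤n)

floor2sqrt-pos : ∀ m → 1 ≤ m → 1 ≤ floor2sqrt m
floor2sqrt-pos (suc m) _ = isqrtAux-pos (4 * suc m) (4 * suc m) (s≤s z≤n) (s≤s z≤n)

q≥7 : ∀ p q → Prime p → p + floor2sqrt (p ∸ 2) + 1 < q → q < 2 * p → 7 ≤ q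
q≥7 0 q p-prime _ _ with () ← nonTrivial⇒n>1 0 {{prime⇒nonTrivial p-prime}}
q≥7 1 q p-prime _ _ with s≤s () ← nonTrivial⇒n>1 1 {{prime⇒nonTrivial p-prime}}
q≥7 2 q _ 4≤q q<4 = ⊥-elim (<⇒≱ q<4 4≤q)
q≥7 3 q _ 7≤q _   = 7≤q
q≥7 p@(suc (suc (suc (suc m)))) q _ p+√+1<q _ =
  ≤-trans (s≤s (+-monoˡ-≤ 1 (+-mono-≤ {4} {p} (s≤s (s≤s (s≤s (s≤s z≤n))))
                                       (floor2sqrt-pos (suc (suc m)) (s≤s z≤n)))))
          p+√+1<q

-- Counting S by cosets of H: Σ_{i=1}^{s} |S_i| ≥ |S| - |S₀| ≥ p + q - 4 ≥ p + 3.
coset-sizes-large : ∀ p q (S : List ℕ) s (a : ℕ → ℕ) → 7 ≤ q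
  → length S ≡ p + q ∸ 2 → sizeS0 p S ≤ 2
  → (∀ b → b ∈ S → ¬ InH p b → ∃[ i ] 1 ≤ i × i ≤ s × SameCoset p b (a i))
  → p + 3 ≤ sumTo s (λ i → cosetSize p S (a i))
coset-sizes-large p q S s a 7≤q |S|≡p+q-2 |S₀|≤2 covered = +-cancelˡ-≤ 2 (p + 3) ΣS (begin
  2 + (p + 3)        ≡⟨ +-comm 2 (p + 3) ⟩
  p + 3 + 2          ≡⟨ +-assoc p 3 2 ⟩
  p + 5              ≤⟨ +-monoʳ-≤ p (∸-monoˡ-≤ 2 7≤q) ⟩
  p + (q ∸ 2)        ≡⟨ +-∸-assoc p (≤-trans (s≤s (s≤s z≤n)) 7≤q) ⟨
  p + q ∸ 2          ≡⟨ |S|≡p+q-2 ⟨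
  length S           ≤⟨ length-≤-cover (InH? p) (λ i → SameCoset? p (a i)) s S cover ⟩
  sizeS0 p S + ΣS     ≤⟨ +-monoˡ-≤ ΣS |S₀|≤2 ⟩
  2 + ΣS              ∎)
  where
  open ≤-Reasoning
  ΣS = sumTo s (λ i → cosetSize p S (a i))

  cover : ∀ b → b ∈ S → InH p b ⊎ ∃[ i ] 1 ≤ i × i ≤ s × SameCoset p (a i) b
  cover b b∈S with InH? p b
  ... | yes b∈H = inj₁ b∈H
  ... | no  b∉H = let i , 1≤i , i≤s , b~aᵢ = covered b b∈S b∉H
                  in inj₂ (i , 1≤i , i≤s , SameCoset-sym p b (a i) b~aᵢ)

sumTo-raise-first : ∀ k (g d : ℕ → ℕ) e → 1 ≤ k
  → sumTo k (λ i → update g 1 (e + g 1) i * d i) ≡ e * d 1 + sumTo k (λ i → g i * d i)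
sumTo-raise-first k g d e 1≤k = +-cancelʳ-≡ (g 1 * d 1) _ _ (begin
  sumTo k F + g 1 * d 1               ≡⟨ sumTo-replace-first k F G 1≤k agree ⟩
  sumTo k G + (e + g 1) * d 1         ≡⟨ cong (sumTo k G +_) (*-distribʳ-+ (d 1) e (g 1)) ⟩
  sumTo k G + (e * d 1 + g 1 * d 1)   ≡⟨ +-assoc (sumTo k G) (e * d 1) (g 1 * d 1) ⟨
  sumTo k G + e * d 1 + g 1 * d 1     ≡⟨ cong (_+ g 1 * d 1) (+-comm (sumTo k G) (e * d 1)) ⟩
  e * d 1 + sumTo k G + g 1 * d 1     ∎)
  where
  open ≡-Reasoning
  F G : ℕ → ℕ
  F i = update g 1 (e + g 1) i * d i
  G i = g i * d i

  agree : ∀ i → 2 ≤ i → F i ≡ G i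
  agree i 2≤i = cong (_* d i) (update-other g 1 (e + g 1) i (>⇒≢ 2≤i))

reserve-first : ∀ p k (c : ℕ → ℕ) → 1 ≤ k → 4 ≤ c 1 → p + 3 ≤ sumTo k c
  → p ≤ 1 + sumTo k (update c 1 (c 1 ∸ 4))
reserve-first p k c 1≤k 4≤c₁ large = +-cancelʳ-≤ 3 p (1 + L) (+-cancelʳ-≤ r (p + 3) (1 + L + 3) (begin
  p + 3 + r        ≤⟨ +-monoˡ-≤ r large ⟩
  sumTo k c + r    ≡⟨ sumTo-replace-first k (update c 1 r) c 1≤k agree ⟨
  L + c 1          ≡⟨ cong (L +_) (m∸n+n≡m 4≤c₁) ⟨
  L + (r + 4)      ≡⟨ regroup L r ⟩
  1 + L + 3 + r    ∎))
  where
  open ≤-Reasoning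
  r = c 1 ∸ 4
  L = sumTo k (update c 1 r)

  agree : ∀ i → 2 ≤ i → update c 1 r i ≡ c i
  agree i 2≤i = update-other c 1 r i (>⇒≢ 2≤i)

  regroup : ∀ L r → L + (r + 4) ≡ 1 + L + 3 + r
  regroup = solve-∀

-- With c_i = |S_i|, choose the lengths len = (c₁ - 4, c₂, …, c_s);
-- their sum is at least p - 1, so every residue x mod p is
-- 2a₁ + Σ g_i a_i with g_i ≤ len_i, and f = (2 + g₁, g₂, …, g_s) is the
-- required representation.
lemma4p7 : (p q : ℕ) → Prime p → Prime q
    → p + floor2sqrt (p ∸ 2) + 1 < q → q < 2 * p
    → (S : List ℕ) → Unique S → All (λ x → 1 ≤ x × x < p * q) S
    → length S ≡ p + q ∸ 2
    → (s : ℕ) (a : ℕ → ℕ)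
    → (∀ i → 1 ≤ i → i ≤ s → a i ∈ S × ¬ InH p (a i))
    → (∀ i j → 1 ≤ i → i ≤ s → 1 ≤ j → j ≤ s → i ≢ j → ¬ SameCoset p (a i) (a j))
    → (∀ b → b ∈ S → ¬ InH p b → Σ ℕ (λ i → 1 ≤ i × i ≤ s × SameCoset p b (a i)))
    → (t r u : ℕ) → t + r + u ≡ s
    → (∀ i j → 1 ≤ i → i ≤ j → j ≤ t → cosetSize p S (a j) ≤ cosetSize p S (a i))
    → (∀ i → 1 ≤ i → i ≤ t → 3 ≤ cosetSize p S (a i))
    → (∀ i → t + 1 ≤ i → i ≤ t + r → cosetSize p S (a i) ≡ 1)
    → (∀ i → t + r + 1 ≤ i → i ≤ t + r + u → cosetSize p S (a i) ≡ 2)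
    → sizeS0 p S ≤ 2
    → 4 ≤ cosetSize p S (a 1)
    → (x : ℕ) → x < p * q
    → Σ (ℕ → ℕ) (λ f →
    (∀ i → 1 ≤ i → i ≤ s → f i ≤ cosetSize p S (a i))
    × 0 < sumTo s f
    × 2 ≤ f 1 × f 1 ≤ cosetSize p S (a 1) ∸ 2
    × SameCoset p x (sumTo s (λ i → f i * a i)))
lemma4p7 p q p-prime _ p+√+1<q q<2p S _ _ |S|≡p+q-2 s a a∉H _ covered _ _ _ _ _ _ _ _ |S₀|≤2 4≤c₁ x _ =
  let g , g≤len , 2a₁+Σ≡x = Residues.progression-sums-cover p (2 * a 1) a len s units
                              (reserve-first p s c 1≤s 4≤c₁ large) x
      f = update g 1 (2 + g 1)
      f₁≤c₁-2 = subst (2 + g 1 ≤_) (sym (+-∸-assoc 2 4≤c₁)) (+-monoʳ-≤ 2 (g≤len 1 ≤-refl 1≤s))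
  in f
   , bounded g g≤len f₁≤c₁-2
   , ≤-trans (m≤m+n 1 (suc (g 1))) (first≤sumTo s f 1≤s)
   , m≤m+n 2 (g 1)
   , f₁≤c₁-2
   , same-residue⇒SameCoset p x _
       (trans (sym 2a₁+Σ≡x) (cong (_% p) (sym (sumTo-raise-first s g a 2 1≤s))))
  where
  instance
    p-nonZero : NonZero p
    p-nonZero = prime⇒nonZero p-prime

  c len : ℕ → ℕ
  c i   = cosetSize p S (a i)
  len   = update c 1 (c 1 ∸ 4)

  large : p + 3 ≤ sumTo s c
  large = coset-sizes-large p q S s a (q≥7 p q p-prime p+√+1<q q<2p) |S|≡p+q-2 |S₀|≤2 covered

  1≤s : 1 ≤ s
  1≤s = sumTo-pos⇒range-pos s c (≤-trans (s≤s z≤n) (≤-trans (m≤n+m 3 p) large))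

  -- every a_i lies outside H, i.e. is a unit modulo the prime p
  units : ∀ i → 1 ≤ i → i ≤ s → Residues.Unit p (a i)
  units i 1≤i i≤s = modular-inverse p p-prime (a i) (proj₂ (a∉H i 1≤i i≤s))

  bounded : ∀ (g : ℕ → ℕ) → (∀ i → 1 ≤ i → i ≤ s → g i ≤ len i) → 2 + g 1 ≤ c 1 ∸ 2
    → ∀ i → 1 ≤ i → i ≤ s → update g 1 (2 + g 1) i ≤ c i
  bounded g g≤len f₁≤c₁-2 (suc zero)    _   _   = ≤-trans f₁≤c₁-2 (m∸n≤m (c 1) 2)
  bounded g g≤len f₁≤c₁-2 (suc (suc i)) 1≤i i≤s = g≤len (suc (suc i)) 1≤i i≤s
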